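{- Let $n,m\ge 1$ and consider the grid $P_n \Box P_m$ with vertices $(x,y)$, $1\le x\le n$, $1\le y\le m$. The four sides of the grid are the vertex sets $\{(1,y)\}_{y}$, $\{(n,y)\}_{y}$, $\{(x,1)\}_{x}$, $\{(x,m)\}_{x}$. For any two distinct sides, the union of their vertex sets is a $1$-forcing set of $P_n\Box P_m$.
   Context: In $P_n\Box P_m$ two vertices $(x,y),(x',y')$ are adjacent iff $|x-x'|+|y-y'|=1$. Color-change rule (zero forcing): given a set of colored vertices, a colored vertex with exactly one uncolored neighbor colors ("forces") that neighbor. Leaks: for a set $L$ of vertices, placing a leak on each $v\in L$ means attaching to $v$ one new pendant vertex (adjacent only to $v$) which is never initially colored; consequently no vertex of $L$ can ever force a vertex of the original graph. A set $S$ of vertices is a $1$-forcing set if for every set $L$ of at most one vertex, starting with exactly $S$ colored and repeatedly applying the color-change rule in the graph with leaks on $L$, every vertex of the original graph eventually becomes colored. -}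

module Defs where

open import Data.Nat using (ℕ; suc; ∣_-_∣; _+_)
open import Data.Fin using (Fin; toℕ)
open import Data.Product using (_×_; _,_)
open import Data.Sum using (_⊎_)
open import Data.Empty using (⊥)
open import Data.Maybe using (Maybe; just; nothing)
open import Relation.Binary.PropositionalEquality using (_≡_; _≢_)
open import Relation.Nullary using (¬_)

-- Vertices of P_n □ P_m, 0-indexed: (x , y) with 0 ≤ x < n, 0 ≤ y < m
-- (paper's (x+1, y+1)).
Vertex : ℕ → ℕ → Set
Vertex n m = Fin n × Fin m

Adj : ∀ {n m} → Vertex n m → Vertex n m → Set
Adj (x , y) (x' , y') = ∣ toℕ x - toℕ x' ∣ + ∣ toℕ y - toℕ y' ∣ ≡ 1

VSet : ℕ → ℕ → Set₁
VSet n m = Vertex n m → Set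

-- Leak set of at most one vertex: nothing = no leak, just v = leak on v.
Leak : ℕ → ℕ → Set
Leak n m = Maybe (Vertex n m)

IsLeaked : ∀ {n m} → Leak n m → Vertex n m → Set
IsLeaked nothing  u = ⊥
IsLeaked (just v) u = v ≡ u

-- Least set containing S and closed
-- under the color-change rule: a colored non-leaked vertex u all of whose
-- neighbours other than w are colored forces its neighbour w.  (A leaked
-- vertex always has its uncolored pendant as a further neighbour, so it can
-- never force a vertex of the original graph; forcing the pendant itself is
-- irrelevant to the original graph.)  Since the rule is monotone, this is
-- exactly the final colored set of the chronological process.
data Colored {n m : ℕ} (S : VSet n m) (L : Leak n m) : Vertex n m → Set where
  init  : ∀ {v} → S v → Colored S L v
  force : ∀ {u w} → Colored S L u → ¬ IsLeaked L u → Adj u w →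
          (∀ w' → Adj u w' → w' ≢ w → Colored S L w') →
          Colored S L w

IsOneForcing : ∀ {n m} → VSet n m → Set
IsOneForcing {n} {m} S = ∀ (L : Leak n m) (v : Vertex n m) → Colored S L v

data Side : Set where
  left right bottom top : Side

OnSide : ∀ {n m} → Side → Vertex n m → Set
OnSide         left   (x , y) = toℕ x ≡ 0
OnSide {n}     right  (x , y) = suc (toℕ x) ≡ n
OnSide         bottom (x , y) = toℕ y ≡ 0
OnSide {_} {m} top    (x , y) = suc (toℕ y) ≡ m

TwoSides : ∀ {n m} → Side → Side → VSet n m
TwoSides s t v = OnSide s v ⊎ OnSide t v

-- Sweep the grid layer by layer away from side s: a vertex in layer k + 1 is forced
-- by its neighbour in layer k, all of whose other neighbours lie in layers ≤ k.
-- A leak at u stalls only the vertex v just behind u.  Since v is no farther from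
-- side t than u is, the same sweep away from t colors v before it meets the leak.
module Submission where

open import Defs
open import Data.Nat using (ℕ; _≤_)
open import Relation.Binary.PropositionalEquality using (_≢_)

open import Data.Nat using (zero; suc; _+_; _∸_; ∣_-_∣; s≤s)
open import Data.Nat.Properties
open import Data.Fin using (Fin; toℕ; inject₁; opposite)
  renaming (zero to fzero; suc to fsuc)
open import Data.Fin.Properties
  using (toℕ-injective; toℕ-inject₁; toℕ<n; opposite-prop; opposite-involutive)
  renaming (_≟_ to _≟ᶠ_)
open import Data.Product using (_×_; _,_; ∃-syntax)
open import Data.Product.Properties using (≡-dec)
open import Data.Sum using (_⊎_; inj₁; inj₂)
open import Data.Maybe using (just; nothing)
open import Function using (_∘_)
open import Relation.Binary.PropositionalEquality
  using (_≡_; refl; sym; trans; cong; cong₂; subst; subst₂; module ≡-Reasoning)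
open import Relation.Nullary using (Dec; yes; no; contradiction)

private
  variable
    n m : ℕ

∣n-1+n∣≡1 : ∀ k → ∣ k - suc k ∣ ≡ 1
∣n-1+n∣≡1 zero    = refl
∣n-1+n∣≡1 (suc k) = ∣n-1+n∣≡1 k

m+n≡1-cases : ∀ a b → a + b ≡ 1 → (a ≡ 0 × b ≡ 1) ⊎ (a ≡ 1 × b ≡ 0)
m+n≡1-cases zero          b       eq = inj₁ (refl , eq)
m+n≡1-cases (suc zero)    zero    _  = inj₂ (refl , refl)
m+n≡1-cases (suc zero)    (suc _) ()
m+n≡1-cases (suc (suc _)) _       ()

∣m-n∣≡1⇒n≡1+m∨m≡1+n : ∀ a b → ∣ a - b ∣ ≡ 1 → b ≡ suc a ⊎ a ≡ suc b
∣m-n∣≡1⇒n≡1+m∨m≡1+n zero          b       eq = inj₁ eq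
∣m-n∣≡1⇒n≡1+m∨m≡1+n (suc zero)    zero    _  = inj₂ refl
∣m-n∣≡1⇒n≡1+m∨m≡1+n (suc (suc _)) zero    ()
∣m-n∣≡1⇒n≡1+m∨m≡1+n (suc a)       (suc b) eq with ∣m-n∣≡1⇒n≡1+m∨m≡1+n a b eq
... | inj₁ b≡1+a = inj₁ (cong suc b≡1+a)
... | inj₂ a≡1+b = inj₂ (cong suc a≡1+b)

∣c∸a-c∸b∣≡∣a-b∣ : ∀ {a b c} → a ≤ c → b ≤ c → ∣ c ∸ a - c ∸ b ∣ ≡ ∣ a - b ∣
∣c∸a-c∸b∣≡∣a-b∣ {a} {b} {c} a≤c b≤c = begin
  ∣ c ∸ a - c ∸ b ∣                     ≡⟨ ∣m+n-m+o∣≡∣n-o∣ (a + b) _ _ ⟨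
  ∣ a + b + (c ∸ a) - a + b + (c ∸ b) ∣ ≡⟨ cong₂ ∣_-_∣ shiftˡ shiftʳ ⟩
  ∣ c + b - c + a ∣                     ≡⟨ ∣m+n-m+o∣≡∣n-o∣ c b a ⟩
  ∣ b - a ∣                             ≡⟨ ∣-∣-comm b a ⟩
  ∣ a - b ∣                             ∎
  where
  open ≡-Reasoning
  shiftˡ : a + b + (c ∸ a) ≡ c + b
  shiftˡ = begin
    a + b + (c ∸ a)   ≡⟨ cong (_+ (c ∸ a)) (+-comm a b) ⟩
    b + a + (c ∸ a)   ≡⟨ +-assoc b a _ ⟩
    b + (a + (c ∸ a)) ≡⟨ cong (b +_) (m+[n∸m]≡n a≤c) ⟩
    b + c             ≡⟨ +-comm b c ⟩
    c + b             ∎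
  shiftʳ : a + b + (c ∸ b) ≡ c + a
  shiftʳ = begin
    a + b + (c ∸ b)   ≡⟨ +-assoc a b _ ⟩
    a + (b + (c ∸ b)) ≡⟨ cong (a +_) (m+[n∸m]≡n b≤c) ⟩
    a + c             ≡⟨ +-comm a c ⟩
    c + a             ∎

opposite-preserves-∣-∣ : (i j : Fin n) →
  ∣ toℕ (opposite i) - toℕ (opposite j) ∣ ≡ ∣ toℕ i - toℕ j ∣
opposite-preserves-∣-∣ {suc n} i j rewrite opposite-prop i | opposite-prop j =
  ∣c∸a-c∸b∣≡∣a-b∣ (≤-pred (toℕ<n i)) (≤-pred (toℕ<n j))

opposite-step : {i j : Fin n} → toℕ j ≡ suc (toℕ i) → toℕ (opposite j) ≤ toℕ (opposite i)
opposite-step {n} {i} {j} j≡1+i rewrite opposite-prop i | opposite-prop j =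
  ∸-monoʳ-≤ n (s≤s (≤-trans (n≤1+n _) (≤-reflexive (sym j≡1+i))))

opposite-step⁻ : {i j : Fin n} →
  toℕ (opposite j) ≡ suc (toℕ (opposite i)) → toℕ j ≤ toℕ i
opposite-step⁻ {i = i} {j} step =
  subst₂ _≤_ (cong toℕ (opposite-involutive j)) (cong toℕ (opposite-involutive i))
    (opposite-step step)

opposite≡0⇒last : (i : Fin n) → toℕ (opposite i) ≡ 0 → suc (toℕ i) ≡ n
opposite≡0⇒last i eq =
  ≤-antisym (toℕ<n i) (m∸n≡0⇒m≤n (trans (sym (opposite-prop i)) eq))

step-≢ : ∀ {A : Set} (f : A → ℕ) {a b : A} → f b ≡ suc (f a) → a ≢ b
step-≢ f step refl = 1+n≰n (≤-reflexive (sym step))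

adj-split : {x x' : Fin n} {y y' : Fin m} → Adj (x , y) (x' , y') →
  (toℕ x ≡ toℕ x' × ∣ toℕ y - toℕ y' ∣ ≡ 1) ⊎ (toℕ y ≡ toℕ y' × ∣ toℕ x - toℕ x' ∣ ≡ 1)
adj-split {x = x} {x'} {y} {y'} adj with m+n≡1-cases _ _ adj
... | inj₁ (dx≡0 , dy≡1) = inj₁ (∣m-n∣≡0⇒m≡n dx≡0 , dy≡1)
... | inj₂ (dx≡1 , dy≡0) = inj₂ (∣m-n∣≡0⇒m≡n dy≡0 , dx≡1)

same-row : {x x' : Fin n} {y y' : Fin m} → Adj (x , y) (x' , y') → x ≢ x' → y ≡ y'
same-row adj x≢x' with adj-split adj
... | inj₁ (x≡x' , _) = contradiction (toℕ-injective x≡x') x≢x'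
... | inj₂ (y≡y' , _) = toℕ-injective y≡y'

same-column : {x x' : Fin n} {y y' : Fin m} → Adj (x , y) (x' , y') → y ≢ y' → x ≡ x'
same-column adj y≢y' with adj-split adj
... | inj₁ (x≡x' , _) = toℕ-injective x≡x'
... | inj₂ (y≡y' , _) = contradiction (toℕ-injective y≡y') y≢y'

adj-≤-or-next : {x x' : Fin n} {y y' : Fin m} → Adj (x , y) (x' , y') →
  toℕ x' ≤ toℕ x ⊎ (toℕ x' ≡ suc (toℕ x) × y ≡ y')
adj-≤-or-next adj with adj-split adj
... | inj₁ (x≡x' , _) = inj₁ (≤-reflexive (sym x≡x'))
... | inj₂ (y≡y' , dx≡1) with ∣m-n∣≡1⇒n≡1+m∨m≡1+n _ _ dx≡1
...   | inj₁ x'≡1+x = inj₂ (x'≡1+x , toℕ-injective y≡y')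
...   | inj₂ x≡1+x' = inj₁ (≤-trans (n≤1+n _) (≤-reflexive (sym x≡1+x')))

leaked? : (L : Leak n m) (u : Vertex n m) → Dec (IsLeaked L u)
leaked? nothing  u = no λ ()
leaked? (just ℓ) u = ≡-dec _≟ᶠ_ _≟ᶠ_ ℓ u

leaked-unique : {L : Leak n m} {u v : Vertex n m} → IsLeaked L u → IsLeaked L v → u ≡ v
leaked-unique {L = just ℓ} ℓ≡u ℓ≡v = trans (sym ℓ≡u) ℓ≡v

-- u can force v once every vertex of depth at most d u is colored.
Parent : (d : Vertex n m → ℕ) (u v : Vertex n m) → Set
Parent d u v = Adj u v × d v ≡ suc (d u) × (∀ w → Adj u w → w ≢ v → d w ≤ d u)

Layered : (d : Vertex n m → ℕ) → Set
Layered {n} {m} d = ∀ (v : Vertex n m) → d v ≡ 0 ⊎ ∃[ u ] Parent d u v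

module _ {S : VSet n m} {L : Leak n m} {d : Vertex n m → ℕ}
         (layered : Layered d) (base : ∀ v → d v ≡ 0 → Colored S L v) where

  LeakChildrenColoredUpTo : ℕ → Set
  LeakChildrenColoredUpTo k =
    ∀ {u v} → Parent d u v → IsLeaked L u → d v ≤ k → Colored S L v

  sweep-upTo : ∀ k → LeakChildrenColoredUpTo k → ∀ v → d v ≤ k → Colored S L v
  forced-by-parent : ∀ k → LeakChildrenColoredUpTo k →
    ∀ {u v} → Parent d u v → d v ≤ k → Colored S L v

  sweep-upTo k leak-children v dv≤k with layered v
  ... | inj₁ dv≡0           = base v dv≡0
  ... | inj₂ (u , u-parent) = forced-by-parent k leak-children u-parent dv≤k

  forced-by-parent zero    _        (_ , v-step , _) dv≤0 =
    contradiction (trans (sym v-step) (n≤0⇒n≡0 dv≤0)) λ ()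
  forced-by-parent (suc k) leak-children {u} u-parent@(u~v , v-step , others) dv≤1+k
    with leaked? L u
  ... | yes u-leaked = leak-children u-parent u-leaked dv≤1+k
  ... | no  u-sound  =
    force (below u du≤k) u-sound u~v λ w u~w w≢v → below w (≤-trans (others w u~w w≢v) du≤k)
    where
    du≤k : d u ≤ k
    du≤k = ≤-pred (subst (_≤ suc k) v-step dv≤1+k)
    below : ∀ w → d w ≤ k → Colored S L w
    below = sweep-upTo k λ p leak dv≤k → leak-children p leak (m≤n⇒m≤1+n dv≤k)

  sweep : (∀ {u v} → Parent d u v → IsLeaked L u → Colored S L v) → ∀ v → Colored S L v
  sweep leak-children v = sweep-upTo (d v) (λ p leak _ → leak-children p leak) v ≤-refl

  sweep-≤leak : ∀ v → (∀ {ℓ} → IsLeaked L ℓ → d v ≤ d ℓ) → Colored S L v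
  sweep-≤leak v v≤leak = sweep-upTo (d v) no-leaked-parent v ≤-refl
    where
    no-leaked-parent : LeakChildrenColoredUpTo (d v)
    no-leaked-parent (_ , w-step , _) u-leaked dw≤dv =
      contradiction (≤-trans (≤-reflexive (sym w-step)) (≤-trans dw≤dv (v≤leak u-leaked)))
                    1+n≰n

record GridIso (n′ m′ n m : ℕ) : Set where
  field
    to       : Vertex n′ m′ → Vertex n m
    from     : Vertex n m → Vertex n′ m′
    from-to  : ∀ u → from (to u) ≡ u
    to-from  : ∀ v → to (from v) ≡ v
    to-adj   : ∀ {u w} → Adj u w → Adj (to u) (to w)
    from-adj : ∀ {u w} → Adj u w → Adj (from u) (from w)

module _ {n′ m′} (iso : GridIso n′ m′ n m) where
  open GridIso iso

  Layered-transport : {d : Vertex n′ m′ → ℕ} → Layered d → Layered (d ∘ from)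
  Layered-transport {d} layered v with layered (from v)
  ... | inj₁ d≡0 = inj₁ d≡0
  ... | inj₂ (u , u~v , v-step , others) = inj₂ (to u , adj , step , others′)
    where
    adj : Adj (to u) v
    adj = subst (Adj (to u)) (to-from v) (to-adj u~v)
    step : d (from v) ≡ suc (d (from (to u)))
    step = trans v-step (cong (suc ∘ d) (sym (from-to u)))
    others′ : ∀ w → Adj (to u) w → w ≢ v → d (from w) ≤ d (from (to u))
    others′ w tu~w w≢v = subst (λ z → d (from w) ≤ d z) (sym (from-to u))
      (others (from w) (subst (λ z → Adj z (from w)) (from-to u) (from-adj tu~w))
        λ fw≡fv → w≢v (trans (sym (to-from w)) (trans (cong to fw≡fv) (to-from v))))

reflect : Vertex n m → Vertex n m
reflect (x , y) = opposite x , y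

reflect-involutive : (v : Vertex n m) → reflect (reflect v) ≡ v
reflect-involutive (x , y) = cong (_, y) (opposite-involutive x)

reflect-adj : {u w : Vertex n m} → Adj u w → Adj (reflect u) (reflect w)
reflect-adj {u = x , y} {w = x' , y'} adj =
  trans (cong (_+ ∣ toℕ y - toℕ y' ∣) (opposite-preserves-∣-∣ x x')) adj

reflect-iso : GridIso n m n m
reflect-iso = record
  { to = reflect ; from = reflect
  ; from-to = reflect-involutive ; to-from = reflect-involutive
  ; to-adj = λ {u} {w} → reflect-adj {u = u} {w}
  ; from-adj = λ {u} {w} → reflect-adj {u = u} {w}
  }

transpose : Vertex n m → Vertex m n
transpose (x , y) = y , x

transpose-adj : {u w : Vertex n m} → Adj u w → Adj (transpose u) (transpose w)
transpose-adj {u = x , y} {w = x' , y'} adj = trans (+-comm ∣ toℕ y - toℕ y' ∣ _) adj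

transpose-iso : GridIso m n n m
transpose-iso = record
  { to = transpose ; from = transpose
  ; from-to = λ _ → refl ; to-from = λ _ → refl
  ; to-adj = λ {u} {w} → transpose-adj {u = u} {w}
  ; from-adj = λ {u} {w} → transpose-adj {u = u} {w}
  }

depth : Side → Vertex n m → ℕ
depth left   (x , y) = toℕ x
depth right  (x , y) = toℕ (opposite x)
depth bottom (x , y) = toℕ y
depth top    (x , y) = toℕ (opposite y)

Layered-left : Layered (depth {n} {m} left)
Layered-left (fzero  , y) = inj₁ refl
Layered-left (fsuc i , y) = inj₂ ((inject₁ i , y) , adj , step , others)
  where
  adj : Adj (inject₁ i , y) (fsuc i , y)
  adj rewrite toℕ-inject₁ i | ∣n-n∣≡0 (toℕ y) = trans (+-identityʳ _) (∣n-1+n∣≡1 (toℕ i))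
  step : suc (toℕ i) ≡ suc (toℕ (inject₁ i))
  step = cong suc (sym (toℕ-inject₁ i))
  others : ∀ w → Adj (inject₁ i , y) w → w ≢ (fsuc i , y) → depth left w ≤ toℕ (inject₁ i)
  others (x' , y') adj′ w≢v with adj-≤-or-next {x = inject₁ i} {x'} {y} {y'} adj′
  ... | inj₁ x'≤ = x'≤
  ... | inj₂ (x'≡1+i , refl) =
    contradiction (cong (_, y) (toℕ-injective (trans x'≡1+i (sym step)))) w≢v

layered : (s : Side) → Layered (depth {n} {m} s)
layered left   = Layered-left
layered right  = Layered-transport reflect-iso Layered-left
layered bottom = Layered-transport transpose-iso Layered-left
layered top    = Layered-transport transpose-iso (layered right)

depth≡0⇒OnSide : (s : Side) (v : Vertex n m) → depth s v ≡ 0 → OnSide s v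
depth≡0⇒OnSide left   (x , y) = λ x≡0 → x≡0
depth≡0⇒OnSide right  (x , y) = opposite≡0⇒last x
depth≡0⇒OnSide bottom (x , y) = λ y≡0 → y≡0
depth≡0⇒OnSide top    (x , y) = opposite≡0⇒last y

depth-step : {s t : Side} → s ≢ t → {u v : Vertex n m} → Adj u v →
  depth s v ≡ suc (depth s u) → depth t v ≤ depth t u
depth-step {s = left}   {left}   s≢t _ _ = contradiction refl s≢t
depth-step {s = right}  {right}  s≢t _ _ = contradiction refl s≢t
depth-step {s = bottom} {bottom} s≢t _ _ = contradiction refl s≢t
depth-step {s = top}    {top}    s≢t _ _ = contradiction refl s≢t
depth-step {s = left}   {right}  _ _ step = opposite-step step
depth-step {s = right}  {left}   _ _ step = opposite-step⁻ step
depth-step {s = bottom} {top}    _ _ step = opposite-step step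
depth-step {s = top}    {bottom} _ _ step = opposite-step⁻ step
depth-step {s = left}   {bottom} _ adj step =
  ≤-reflexive (cong toℕ (sym (same-row adj (step-≢ toℕ step))))
depth-step {s = left}   {top}    _ adj step =
  ≤-reflexive (cong (toℕ ∘ opposite) (sym (same-row adj (step-≢ toℕ step))))
depth-step {s = right}  {bottom} _ adj step =
  ≤-reflexive (cong toℕ (sym (same-row adj (step-≢ (toℕ ∘ opposite) step))))
depth-step {s = right}  {top}    _ adj step =
  ≤-reflexive (cong (toℕ ∘ opposite) (sym (same-row adj (step-≢ (toℕ ∘ opposite) step))))
depth-step {s = bottom} {left}   _ adj step =
  ≤-reflexive (cong toℕ (sym (same-column adj (step-≢ toℕ step))))
depth-step {s = bottom} {right}  _ adj step =
  ≤-reflexive (cong (toℕ ∘ opposite) (sym (same-column adj (step-≢ toℕ step))))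
depth-step {s = top}    {left}   _ adj step =
  ≤-reflexive (cong toℕ (sym (same-column adj (step-≢ (toℕ ∘ opposite) step))))
depth-step {s = top}    {right}  _ adj step =
  ≤-reflexive (cong (toℕ ∘ opposite) (sym (same-column adj (step-≢ (toℕ ∘ opposite) step))))

side-colored : ∀ s {S : VSet n m} {L} → (∀ v → OnSide s v → S v) →
  ∀ v → depth s v ≡ 0 → Colored S L v
side-colored s on-S v dv≡0 = init (on-S v (depth≡0⇒OnSide s v dv≡0))

lemma30 : (n m : ℕ) → 1 ≤ n → 1 ≤ m → (s t : Side) → s ≢ t →
    IsOneForcing {n} {m} (TwoSides s t)
lemma30 n m _ _ s t s≢t L =
  sweep (layered s) (side-colored s λ _ → inj₁) behind-leak
  where
  behind-leak : ∀ {u v} → Parent (depth s) u v → IsLeaked L u → Colored (TwoSides s t) L v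
  behind-leak {v = v} (u~v , v-step , _) u-leaked =
    sweep-≤leak (layered t) (side-colored t λ _ → inj₂) v λ ℓ-leaked →
      subst (λ ℓ → depth t v ≤ depth t ℓ) (leaked-unique u-leaked ℓ-leaked)
        (depth-step s≢t u~v v-step)
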